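{- In the setting of the context, if $p_{2m+1}\ge p_1-p_m$ and $C_m^{LPT'}=p_{2m+1}+p_m+p_{2m}$, then the makespan returned by LPT-REV is at most $\frac{7}{6}C_m^*$.
   Context: Problem $P_m\|C_{max}$ with $m\ge3$ identical machines and $n=2m+1$ jobs with processing times $p_1\ge p_2\ge\dots\ge p_{2m+1}\ge0$; the makespan is the maximum machine load and $C_m^*$ is the optimal makespan. List Scheduling (LS) assigns jobs of an ordered list one at a time to a machine with currently smallest load; LPT is LS on order $1,\dots,n$. It is assumed that, in the LPT schedule, for each $i=1,\dots,m$ jobs $i$ and $2m+1-i$ are assigned to the same machine $M_i$ before job $2m+1$ is assigned, and that job $2m+1$ is the critical job (the last job on a machine whose load equals the LPT makespan). $LPT'$ is the schedule obtained by first placing job $2m+1$ alone on machine $M_1$ and then applying LS to jobs $1,\dots,2m$ in this order; $C_m^{LPT'}$ is its makespan. LPT-REV returns the best among the LPT schedule, $LPT'$, and the schedule $LPT''$ obtained by first placing together on one machine the jobs $2m+2-k,\dots,2m+1$, where $k-1$ is the number of jobs on the LPT critical machine before job $2m+1$, and then applying LS to the remaining jobs in non-increasing order of processing time.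
   Formalization: The processing times $p_1\ge p_2\ge\dots\ge p_{2m+1}\ge0$ are rational numbers. -}

module Defs where

open import Data.Nat as ℕ using (ℕ; zero; suc; _∸_)
open import Data.Fin using (Fin; _≟_)
open import Data.List using (List; []; _∷_; foldr; filter; length; allFin)
open import Data.Product using (_×_)
open import Data.Unit using (⊤)
open import Relation.Nullary using (yes; no)
open import Relation.Binary.PropositionalEquality using (_≡_)
open import Data.Rational using (ℚ; 0ℚ; _+_; _≤_; _⊔_)

-- Jobs are numbered 1, …, n (natural numbers); machines are Fin m.
-- Processing times: a function ℕ → ℚ (only values at 1..n matter).
-- A schedule assigns every job a machine: ℕ → Fin m.

interval : ℕ → ℕ → List ℕ
interval a zero    = []
interval a (suc l) = a ∷ interval (suc a) l

jobs : ℕ → List ℕ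
jobs n = interval 1 n

N : ℕ → ℕ
N m = 2 ℕ.* m ℕ.+ 1

load : {m : ℕ} → (ℕ → ℚ) → (ℕ → Fin m) → List ℕ → Fin m → ℚ
load p a []       i = 0ℚ
load p a (j ∷ js) i with a j ≟ i
... | yes _ = p j + load p a js i
... | no  _ = load p a js i

makespan : (m n : ℕ) → (ℕ → ℚ) → (ℕ → Fin m) → ℚ
makespan m n p a = foldr (λ i acc → load p a (jobs n) i ⊔ acc) 0ℚ (allFin m)

-- IsLS p a done todo: the schedule a arises from List Scheduling applied
-- to the jobs of the list `todo` in this order, starting from the partial
-- schedule in which exactly the jobs of `done` are already placed (as in a):
-- each job is put on a machine whose current load is smallest
-- (ties broken arbitrarily).
IsLS : {m : ℕ} → (ℕ → ℚ) → (ℕ → Fin m) → List ℕ → List ℕ → Set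
IsLS p a done []         = ⊤
IsLS p a done (j ∷ todo) =
  ((i : _) → load p a done (a j) ≤ load p a done i) × IsLS p a (j ∷ done) todo

-- number of jobs among 1..n-1 placed on the same machine as job n (= k-1
-- in the paper, for n = 2m+1 and a the LPT schedule)
jobsBefore : {m : ℕ} → (ℕ → Fin m) → ℕ → ℕ
jobsBefore a n = length (filter (λ j → a j ≟ a n) (jobs (n ∸ 1)))

-- LPT-REV returns a schedule no worse than LPT′, whose makespan is
-- p(2m+1) + p(m) + p(2m) by hypothesis, so it suffices to compare this sum
-- with the makespan C of an arbitrary schedule σ.  Since 2m+1 jobs run on m
-- machines, some machine carries three jobs, at most one of which is job
-- 2m+1; hence C ≥ 2 p(2m) + p(2m+1).  Moreover, either two of the m longest
-- jobs share a machine, so C ≥ 2 p(m), or each machine carries exactly one of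
-- them and one of the m+1 remaining jobs joins another one, so that
-- C ≥ p(m) + p(2m) + p(2m+1) outright.  In the first case
-- ½ · 2 p(m) + ⅔ · (2 p(2m) + p(2m+1)) exceeds the sum by (p(2m) − p(2m+1))/3 ≥ 0.
module Submission where

open import Defs
open import Data.Nat as ℕ using (ℕ; zero; suc; _∸_; z≤n; s≤s)
import Data.Nat.Properties as ℕₚ
open import Data.Fin using (Fin; _≟_; punchIn) renaming (zero to fzero; suc to fsuc)
open import Data.List using (List; []; _∷_; _++_; [_]; length; filter; foldr; allFin)
open import Data.List.Properties using (length-++; filter-++; length-filter; ++-assoc)
open import Data.List.Membership.Propositional using (_∈_)
open import Data.List.Membership.Propositional.Properties using (∈-allFin)
open import Data.List.Relation.Unary.Any using (here; there)
open import Data.List.Relation.Unary.All as All using (All; []; _∷_)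
open import Data.List.Relation.Unary.All.Properties using (++⁺)
open import Data.Product using (∃; _×_; _,_)
open import Data.Sum using (_⊎_; inj₁; inj₂)
open import Data.Integer using (+_)
open import Function using (_∘_)
open import Relation.Nullary using (yes; no; does; contradiction)
open import Relation.Binary.PropositionalEquality
  using (_≡_; refl; sym; trans; cong; cong₂; subst; module ≡-Reasoning)
open import Algebra.Properties.CommutativeMonoid.Sum ℕₚ.+-0-commutativeMonoid
  using (sum; sum-syntax)

module Counting where

  open import Data.Bool using (if_then_else_)
  open import Data.Fin.Properties using (any?)
  open import Data.Nat using (_+_; _*_; _≤_; _<_)
  open import Data.Nat.Properties
    using (_<?_; _≤?_; ≮⇒≥; <⇒≱; ≤-reflexive; +-mono-≤; +-mono-<-≤; *-identityʳ)
  open import Data.Vec.Functional using (removeAt)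
  open import Algebra.Properties.CommutativeMonoid.Sum ℕₚ.+-0-commutativeMonoid
    using (sum-cong-≗; ∑-distrib-+; sum-remove; sum-replicate-zero)

  δ : {n : ℕ} → Fin n → Fin n → ℕ
  δ y i = if does (y ≟ i) then 1 else 0

  ∑-δ : ∀ {n} (y : Fin n) → ∑[ i < n ] δ y i ≡ 1
  ∑-δ {suc n} fzero    = cong suc (sum-replicate-zero n)
  ∑-δ {suc n} (fsuc y) = ∑-δ y

  count : {m : ℕ} → (ℕ → Fin m) → List ℕ → Fin m → ℕ
  count a js i = length (filter (λ j → a j ≟ i) js)

  count-[] : ∀ {m} (a : ℕ → Fin m) j i → count a [ j ] i ≡ δ (a j) i
  count-[] a j i with a j ≟ i
  ... | yes _ = refl
  ... | no  _ = refl

  count-++ : ∀ {m} (a : ℕ → Fin m) xs ys i → count a (xs ++ ys) i ≡ count a xs i + count a ys i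
  count-++ a xs ys i =
    trans (cong length (filter-++ (λ j → a j ≟ i) xs ys)) (length-++ (filter (λ j → a j ≟ i) xs))

  count≤length : ∀ {m} (a : ℕ → Fin m) js i → count a js i ≤ length js
  count≤length a js i = length-filter (λ j → a j ≟ i) js

  ∑-count : ∀ {m} (a : ℕ → Fin m) js → ∑[ i < m ] count a js i ≡ length js
  ∑-count {m} a []       = sum-replicate-zero m
  ∑-count {m} a (j ∷ js) = begin
    ∑[ i < m ] count a ([ j ] ++ js) i                   ≡⟨ sum-cong-≗ (count-++ a [ j ] js) ⟩
    ∑[ i < m ] (count a [ j ] i + count a js i)          ≡⟨ ∑-distrib-+ (count a [ j ]) (count a js) ⟩
    ∑[ i < m ] count a [ j ] i + ∑[ i < m ] count a js i ≡⟨ cong₂ _+_ ∑-count-[] (∑-count a js) ⟩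
    suc (length js)                                      ∎
    where
    open ≡-Reasoning
    ∑-count-[] : ∑[ i < m ] count a [ j ] i ≡ 1
    ∑-count-[] = trans (sum-cong-≗ (count-[] a j)) (∑-δ (a j))

  ∑-≤ : ∀ {n} (f : Fin n → ℕ) {k} → (∀ i → f i ≤ k) → ∑[ i < n ] f i ≤ n * k
  ∑-≤ {zero}  f f≤k = z≤n
  ∑-≤ {suc n} f f≤k = +-mono-≤ (f≤k fzero) (∑-≤ (f ∘ fsuc) (f≤k ∘ fsuc))

  ∑-< : ∀ {n} (f : Fin n → ℕ) {k} → (∀ i → f i ≤ k) → ∀ i → f i < k → ∑[ i < n ] f i < n * k
  ∑-< {suc n} f {k} f≤k i fi<k = begin-strict
    sum f                    ≡⟨ sum-remove {i = i} f ⟩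
    f i + sum (removeAt f i) <⟨ +-mono-<-≤ fi<k (∑-≤ (removeAt f i) (f≤k ∘ punchIn i)) ⟩
    k + n * k                ∎
    where open ℕₚ.≤-Reasoning

  pigeonhole-∑ : ∀ {n} (f : Fin n → ℕ) {k} → n * k < ∑[ i < n ] f i → ∃ λ i → k < f i
  pigeonhole-∑ f {k} n*k<∑f with any? (λ i → k <? f i)
  ... | yes found = found
  ... | no  none  = contradiction (∑-≤ f (λ i → ≮⇒≥ (λ k<fi → none (i , k<fi)))) (<⇒≱ n*k<∑f)

  ∑-saturated : ∀ {n} (f : Fin n → ℕ) {k} → (∀ i → f i ≤ k) → n * k ≤ ∑[ i < n ] f i →
                ∀ i → k ≤ f i
  ∑-saturated f f≤k n*k≤∑f i = ≮⇒≥ (λ fi<k → <⇒≱ (∑-< f f≤k i fi<k) n*k≤∑f)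

  pigeonhole-mixed : ∀ {n} (f g : Fin n → ℕ) → ∑[ i < n ] f i ≡ n → n < ∑[ i < n ] g i →
                     (∃ λ i → 2 ≤ f i) ⊎ (∃ λ i → 1 ≤ f i × 2 ≤ g i)
  pigeonhole-mixed {n} f g ∑f≡n n<∑g with any? (λ i → 2 ≤? f i)
  ... | yes doubled = inj₁ doubled
  ... | no  none with pigeonhole-∑ g (subst (_< sum g) (sym (*-identityʳ n)) n<∑g)
  ...   | i , 1<gi = inj₂ (i , f-saturated i , 1<gi)
    where
    f-saturated : ∀ i → 1 ≤ f i
    f-saturated = ∑-saturated f (λ i → ≮⇒≥ (λ 1<fi → none (i , 1<fi)))
                    (≤-reflexive (trans (*-identityʳ n) (sym ∑f≡n)))

open Counting

-- Imported only here: inside Counting these operators would clash with those on ℕ.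
open import Data.Rational using (ℚ; 0ℚ; _+_; _*_; _≤_; _⊓_; _⊔_; _/_)
import Data.Rational.Properties as ℚₚ
open import Data.Rational.Solver using (module +-*-Solver)
open import Algebra.Properties.Monoid.Mult ℚₚ.+-0-monoid using (×-homo-1) renaming (_×_ to _·_)

·-nonNeg : ∀ k {c} → 0ℚ ≤ c → 0ℚ ≤ k · c
·-nonNeg zero    0≤c = ℚₚ.≤-refl
·-nonNeg (suc k) 0≤c = ℚₚ.+-mono-≤ 0≤c (·-nonNeg k 0≤c)

·-monoˡ-≤ : ∀ {c k k′} → 0ℚ ≤ c → k ℕ.≤ k′ → k · c ≤ k′ · c
·-monoˡ-≤ {k′ = k′} 0≤c z≤n        = ·-nonNeg k′ 0≤c
·-monoˡ-≤ {c}       0≤c (s≤s k≤k′) = ℚₚ.+-monoʳ-≤ c (·-monoˡ-≤ 0≤c k≤k′)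

·+-lowerBound : ∀ k {k₁} k₂ {c₁ c₂} → 0ℚ ≤ c₂ → c₂ ≤ c₁ → k₂ ℕ.≤ 1 → suc k ℕ.≤ k₁ ℕ.+ k₂ →
                k · c₁ + c₂ ≤ k₁ · c₁ + k₂ · c₂
·+-lowerBound k {k₁} 0 {c₁} {c₂} 0≤c₂ c₂≤c₁ _ k<k₁+0 = begin
  k · c₁ + c₂   ≤⟨ ℚₚ.+-monoʳ-≤ (k · c₁) c₂≤c₁ ⟩
  k · c₁ + c₁   ≡⟨ ℚₚ.+-comm (k · c₁) c₁ ⟩
  suc k · c₁    ≤⟨ ·-monoˡ-≤ (ℚₚ.≤-trans 0≤c₂ c₂≤c₁)
                               (subst (suc k ℕ.≤_) (ℕₚ.+-identityʳ k₁) k<k₁+0) ⟩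
  k₁ · c₁       ≡⟨ ℚₚ.+-identityʳ (k₁ · c₁) ⟨
  k₁ · c₁ + 0ℚ  ∎
  where open ℚₚ.≤-Reasoning
·+-lowerBound k {k₁} 1 {c₁} {c₂} 0≤c₂ c₂≤c₁ _ k<k₁+1 =
  ℚₚ.+-mono-≤ (·-monoˡ-≤ (ℚₚ.≤-trans 0≤c₂ c₂≤c₁) k≤k₁) (ℚₚ.≤-reflexive (sym (×-homo-1 c₂)))
  where
  k≤k₁ : k ℕ.≤ k₁
  k≤k₁ = ℕₚ.≤-pred (subst (suc k ℕ.≤_) (ℕₚ.+-comm k₁ 1) k<k₁+1)
·+-lowerBound k (suc (suc _)) _ _ (s≤s ()) _

⁷⁄₆-bound : ∀ {a b x C} → 0ℚ ≤ a → a ≤ b → 2 · b + a ≤ C → 2 · x ≤ C ⊎ x + (b + a) ≤ C →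
            a + x + b ≤ (+ 7 / 6) * C
⁷⁄₆-bound {a} {b} {x} {C} 0≤a a≤b 2b+a≤C (inj₁ 2x≤C) = begin
  a + x + b                                     ≡⟨ split-a ⟩
  (+ 1 / 3) * a + ((+ 2 / 3) * a + x + b)       ≤⟨ ℚₚ.+-monoˡ-≤ _ (ℚₚ.*-monoˡ-≤-nonNeg (+ 1 / 3) a≤b) ⟩
  (+ 1 / 3) * b + ((+ 2 / 3) * a + x + b)       ≡⟨ regroup ⟩
  (+ 1 / 2) * (2 · x) + (+ 2 / 3) * (2 · b + a) ≤⟨ ℚₚ.+-mono-≤ (ℚₚ.*-monoˡ-≤-nonNeg (+ 1 / 2) 2x≤C)
                                                                 (ℚₚ.*-monoˡ-≤-nonNeg (+ 2 / 3) 2b+a≤C) ⟩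
  (+ 1 / 2) * C + (+ 2 / 3) * C                 ≡⟨ solve 1 (λ C → con (+ 1 / 2) :* C :+ con (+ 2 / 3) :* C
                                                     := con (+ 7 / 6) :* C) refl C ⟩
  (+ 7 / 6) * C                                 ∎
  where
  open ℚₚ.≤-Reasoning
  open +-*-Solver
  split-a : a + x + b ≡ (+ 1 / 3) * a + ((+ 2 / 3) * a + x + b)
  split-a = solve 3 (λ a x b → (a :+ x) :+ b
                      := con (+ 1 / 3) :* a :+ ((con (+ 2 / 3) :* a :+ x) :+ b)) refl a x b
  regroup : (+ 1 / 3) * b + ((+ 2 / 3) * a + x + b) ≡ (+ 1 / 2) * (2 · x) + (+ 2 / 3) * (2 · b + a)
  regroup = solve 3 (λ a x b → con (+ 1 / 3) :* b :+ ((con (+ 2 / 3) :* a :+ x) :+ b)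
                      := con (+ 1 / 2) :* (x :+ (x :+ con 0ℚ))
                         :+ con (+ 2 / 3) :* ((b :+ (b :+ con 0ℚ)) :+ a)) refl a x b
⁷⁄₆-bound {a} {b} {x} {C} 0≤a a≤b 2b+a≤C (inj₂ x+b+a≤C) = begin
  a + x + b            ≡⟨ solve 3 (λ a x b → (a :+ x) :+ b := x :+ (b :+ a)) refl a x b ⟩
  x + (b + a)          ≤⟨ x+b+a≤C ⟩
  C                    ≡⟨ ℚₚ.+-identityʳ C ⟨
  C + 0ℚ               ≤⟨ ℚₚ.+-monoʳ-≤ C (ℚₚ.*-monoˡ-≤-nonNeg (+ 1 / 6) 0≤C) ⟩
  C + (+ 1 / 6) * C    ≡⟨ solve 1 (λ C → C :+ con (+ 1 / 6) :* C := con (+ 7 / 6) :* C) refl C ⟩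
  (+ 7 / 6) * C        ∎
  where
  open ℚₚ.≤-Reasoning
  open +-*-Solver
  0≤C : 0ℚ ≤ C
  0≤C = ℚₚ.≤-trans (ℚₚ.+-mono-≤ (·-nonNeg 2 (ℚₚ.≤-trans 0≤a a≤b)) 0≤a) 2b+a≤C

module _ {m : ℕ} (p : ℕ → ℚ) (a : ℕ → Fin m) where

  load-++ : ∀ xs ys i → load p a (xs ++ ys) i ≡ load p a xs i + load p a ys i
  load-++ []       ys i = sym (ℚₚ.+-identityˡ _)
  load-++ (j ∷ xs) ys i with a j ≟ i
  ... | yes _ = trans (cong (_+_ (p j)) (load-++ xs ys i)) (sym (ℚₚ.+-assoc (p j) _ _))
  ... | no  _ = load-++ xs ys i

  count·≤load : ∀ {c js} → All (λ j → c ≤ p j) js → ∀ i → count a js i · c ≤ load p a js i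
  count·≤load []                      i = ℚₚ.≤-refl
  count·≤load {js = j ∷ _} (c≤pj ∷ cs) i with a j ≟ i
  ... | yes _ = ℚₚ.+-mono-≤ c≤pj (count·≤load cs i)
  ... | no  _ = count·≤load cs i

  load-++-lowerBound : ∀ {c₁ c₂} ys zs {k} i → 0ℚ ≤ c₂ → c₂ ≤ c₁ →
    All (λ j → c₁ ≤ p j) ys → All (λ j → c₂ ≤ p j) zs → length zs ℕ.≤ 1 →
    suc k ℕ.≤ count a (ys ++ zs) i → k · c₁ + c₂ ≤ load p a (ys ++ zs) i
  load-++-lowerBound {c₁} {c₂} ys zs {k} i 0≤c₂ c₂≤c₁ ys≥c₁ zs≥c₂ |zs|≤1 k<count = begin
    k · c₁ + c₂                          ≤⟨ ·+-lowerBound k (count a zs i) 0≤c₂ c₂≤c₁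
                                              (ℕₚ.≤-trans (count≤length a zs i) |zs|≤1)
                                              (subst (suc k ℕ.≤_) (count-++ a ys zs i) k<count) ⟩
    count a ys i · c₁ + count a zs i · c₂ ≤⟨ ℚₚ.+-mono-≤ (count·≤load ys≥c₁ i) (count·≤load zs≥c₂ i) ⟩
    load p a ys i + load p a zs i        ≡⟨ load-++ ys zs i ⟨
    load p a (ys ++ zs) i                ∎
    where open ℚₚ.≤-Reasoning

foldr-⊔-upperBound : ∀ {A : Set} (f : A → ℚ) {x} xs → x ∈ xs → f x ≤ foldr (λ y acc → f y ⊔ acc) 0ℚ xs
foldr-⊔-upperBound f (y ∷ xs) (here refl)  = ℚₚ.p≤p⊔q (f y) _
foldr-⊔-upperBound f (y ∷ xs) (there x∈xs) =
  ℚₚ.≤-trans (foldr-⊔-upperBound f xs x∈xs) (ℚₚ.p≤q⊔p (f y) _)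

load≤makespan : ∀ {m} n p (a : ℕ → Fin m) i → load p a (jobs n) i ≤ makespan m n p a
load≤makespan n p a i = foldr-⊔-upperBound (load p a (jobs n)) (allFin _) (∈-allFin i)

interval-++ : ∀ s l₁ l₂ → interval s (l₁ ℕ.+ l₂) ≡ interval s l₁ ++ interval (s ℕ.+ l₁) l₂
interval-++ s zero     l₂ = cong (λ t → interval t l₂) (sym (ℕₚ.+-identityʳ s))
interval-++ s (suc l₁) l₂ = cong (s ∷_) (begin
  interval (suc s) (l₁ ℕ.+ l₂)                          ≡⟨ interval-++ (suc s) l₁ l₂ ⟩
  interval (suc s) l₁ ++ interval (suc s ℕ.+ l₁) l₂     ≡⟨ cong (λ t → interval (suc s) l₁ ++ interval t l₂)
                                                               (ℕₚ.+-suc s l₁) ⟨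
  interval (suc s) l₁ ++ interval (s ℕ.+ suc l₁) l₂     ∎)
  where open ≡-Reasoning

length-interval : ∀ s l → length (interval s l) ≡ l
length-interval s zero    = refl
length-interval s (suc l) = cong suc (length-interval (suc s) l)

All-interval : ∀ {P : ℕ → Set} s l → (∀ j → s ℕ.≤ j → j ℕ.< s ℕ.+ l → P j) → All P (interval s l)
All-interval s zero    P-in-range = []
All-interval s (suc l) P-in-range =
  P-in-range s ℕₚ.≤-refl (ℕₚ.m<m+n s (s≤s z≤n)) ∷
  All-interval (suc s) l (λ j s<j j<1+s+l →
    P-in-range j (ℕₚ.<⇒≤ s<j) (subst (j ℕ.<_) (sym (ℕₚ.+-suc s l)) j<1+s+l))

module _ {m : ℕ} (1≤m : 1 ℕ.≤ m) (p : ℕ → ℚ)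
         (p-nonneg : (j : ℕ) → 1 ℕ.≤ j → j ℕ.≤ N m → 0ℚ ≤ p j)
         (p-antitone : (i j : ℕ) → 1 ℕ.≤ i → i ℕ.≤ j → j ℕ.≤ N m → p j ≤ p i)
         (σ : ℕ → Fin m) where

  private
    C = makespan m (N m) p σ
    x = p m
    b = p (2 ℕ.* m)
    a = p (N m)

    m≤2m : m ℕ.≤ 2 ℕ.* m
    m≤2m = ℕₚ.m≤m+n m (m ℕ.+ 0)
    2m≤N : 2 ℕ.* m ℕ.≤ N m
    2m≤N = ℕₚ.m≤m+n (2 ℕ.* m) 1

    a≤b : a ≤ b
    a≤b = p-antitone (2 ℕ.* m) (N m) (ℕₚ.≤-trans 1≤m m≤2m) 2m≤N ℕₚ.≤-refl
    0≤a : 0ℚ ≤ a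
    0≤a = p-nonneg (N m) (ℕₚ.≤-trans 1≤m (ℕₚ.≤-trans m≤2m 2m≤N)) ℕₚ.≤-refl
    0≤x : 0ℚ ≤ x
    0≤x = ℚₚ.≤-trans 0≤a (ℚₚ.≤-trans a≤b (p-antitone m (2 ℕ.* m) 1≤m m≤2m 2m≤N))

    firstHalf long middle rest : List ℕ
    firstHalf = interval 1 (2 ℕ.* m)
    long      = interval 1 m
    middle    = interval (suc m) m
    rest      = middle ++ [ N m ]

    jobs-split : jobs (N m) ≡ firstHalf ++ [ N m ]
    jobs-split = trans (interval-++ 1 (2 ℕ.* m) 1)
                       (cong (λ t → firstHalf ++ [ t ]) (ℕₚ.+-comm 1 (2 ℕ.* m)))

    jobs-split′ : jobs (N m) ≡ long ++ rest
    jobs-split′ = begin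
      jobs (N m)                                     ≡⟨ jobs-split ⟩
      firstHalf ++ [ N m ]                           ≡⟨ cong (_++ [ N m ]) (interval-++ 1 m (m ℕ.+ 0)) ⟩
      (long ++ interval (suc m) (m ℕ.+ 0)) ++ [ N m ] ≡⟨ cong (λ l → (long ++ interval (suc m) l) ++ [ N m ])
                                                            (ℕₚ.+-identityʳ m) ⟩
      (long ++ middle) ++ [ N m ]                    ≡⟨ ++-assoc long middle [ N m ] ⟩
      long ++ rest                                   ∎
      where open ≡-Reasoning

    last≥a : All (λ j → a ≤ p j) [ N m ]
    last≥a = ℚₚ.≤-refl ∷ []
    firstHalf≥b : All (λ j → b ≤ p j) firstHalf
    firstHalf≥b = All-interval 1 (2 ℕ.* m) (λ j 1≤j j<1+2m →
      p-antitone j (2 ℕ.* m) 1≤j (ℕₚ.≤-pred j<1+2m) 2m≤N)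
    long≥x : All (λ j → x ≤ p j) long
    long≥x = All-interval 1 m (λ j 1≤j j<1+m →
      p-antitone j m 1≤j (ℕₚ.≤-pred j<1+m) (ℕₚ.≤-trans m≤2m 2m≤N))
    middle≥b : All (λ j → b ≤ p j) middle
    middle≥b = All-interval (suc m) m (λ j m<j j<1+m+m →
      p-antitone j (2 ℕ.* m) (ℕₚ.≤-trans (s≤s z≤n) m<j)
        (subst (j ℕ.≤_) (cong (ℕ._+_ m) (sym (ℕₚ.+-identityʳ m))) (ℕₚ.≤-pred j<1+m+m)) 2m≤N)
    rest≥a : All (λ j → a ≤ p j) rest
    rest≥a = ++⁺ (All.map (ℚₚ.≤-trans a≤b) middle≥b) last≥a

    machine-with-three-jobs : ∃ λ i → 2 ℕ.< count σ (jobs (N m)) i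
    machine-with-three-jobs = pigeonhole-∑ (count σ (jobs (N m))) (begin-strict
      m ℕ.* 2                               ≡⟨ ℕₚ.*-comm m 2 ⟩
      2 ℕ.* m                               <⟨ ℕₚ.m<m+n (2 ℕ.* m) (s≤s z≤n) ⟩
      N m                                   ≡⟨ length-interval 1 (N m) ⟨
      length (jobs (N m))                   ≡⟨ ∑-count σ (jobs (N m)) ⟨
      ∑[ i < m ] count σ (jobs (N m)) i     ∎)
      where open ℕₚ.≤-Reasoning

    long+rest≤C : ∀ i → load p σ long i + load p σ rest i ≤ C
    long+rest≤C i = begin
      load p σ long i + load p σ rest i  ≡⟨ load-++ p σ long rest i ⟨
      load p σ (long ++ rest) i          ≡⟨ cong (λ js → load p σ js i) jobs-split′ ⟨
      load p σ (jobs (N m)) i            ≤⟨ load≤makespan (N m) p σ i ⟩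
      C                                  ∎
      where open ℚₚ.≤-Reasoning

    2b+a≤C : 2 · b + a ≤ C
    2b+a≤C with i , 2<count ← machine-with-three-jobs = begin
      2 · b + a                          ≤⟨ load-++-lowerBound p σ firstHalf [ N m ] i 0≤a a≤b firstHalf≥b last≥a
                                              ℕₚ.≤-refl (subst (λ js → 2 ℕ.< count σ js i) jobs-split 2<count) ⟩
      load p σ (firstHalf ++ [ N m ]) i  ≡⟨ cong (λ js → load p σ js i) jobs-split ⟨
      load p σ (jobs (N m)) i            ≤⟨ load≤makespan (N m) p σ i ⟩
      C                                  ∎
      where open ℚₚ.≤-Reasoning

    2x≤C⊎x+b+a≤C : 2 · x ≤ C ⊎ x + (b + a) ≤ C
    2x≤C⊎x+b+a≤C with pigeonhole-mixed (count σ long) (count σ rest) ∑long≡m m<∑rest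
      where
      ∑long≡m : ∑[ i < m ] count σ long i ≡ m
      ∑long≡m = trans (∑-count σ long) (length-interval 1 m)
      m<∑rest : m ℕ.< ∑[ i < m ] count σ rest i
      m<∑rest = subst (m ℕ.<_)
        (sym (trans (∑-count σ rest) (trans (length-++ middle) (cong (ℕ._+ 1) (length-interval (suc m) m)))))
        (ℕₚ.m<m+n m (s≤s z≤n))
    ... | inj₁ (i , 2≤long) = inj₁ (begin
      2 · x                              ≤⟨ ·-monoˡ-≤ 0≤x 2≤long ⟩
      count σ long i · x                 ≤⟨ count·≤load p σ long≥x i ⟩
      load p σ long i                    ≡⟨ ℚₚ.+-identityʳ (load p σ long i) ⟨
      load p σ long i + 0ℚ               ≤⟨ ℚₚ.+-monoʳ-≤ (load p σ long i)
                                              (ℚₚ.≤-trans (·-nonNeg (count σ rest i) 0≤a) (count·≤load p σ rest≥a i)) ⟩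
      load p σ long i + load p σ rest i  ≤⟨ long+rest≤C i ⟩
      C                                  ∎)
      where open ℚₚ.≤-Reasoning
    ... | inj₂ (i , 1≤long , 2≤rest) = inj₂ (begin
      x + (b + a)                        ≡⟨ cong₂ (λ u v → u + (v + a)) (×-homo-1 x) (×-homo-1 b) ⟨
      1 · x + (1 · b + a)                ≤⟨ ℚₚ.+-mono-≤ (ℚₚ.≤-trans (·-monoˡ-≤ 0≤x 1≤long) (count·≤load p σ long≥x i))
                                              (load-++-lowerBound p σ middle [ N m ] i 0≤a a≤b middle≥b last≥a
                                                ℕₚ.≤-refl 2≤rest) ⟩
      load p σ long i + load p σ rest i  ≤⟨ long+rest≤C i ⟩
      C                                  ∎)
      where open ℚₚ.≤-Reasoning

  p[N]+p[m]+p[2m]≤⁷⁄₆makespan : p (N m) + p m + p (2 ℕ.* m) ≤ (+ 7 / 6) * makespan m (N m) p σ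
  p[N]+p[m]+p[2m]≤⁷⁄₆makespan = ⁷⁄₆-bound 0≤a a≤b 2b+a≤C 2x≤C⊎x+b+a≤C

proposition11 :
    (m : ℕ) → 3 ℕ.≤ m →
    (p : ℕ → ℚ) →
    ((j : ℕ) → 1 ℕ.≤ j → j ℕ.≤ N m → 0ℚ ≤ p j) →
    ((i j : ℕ) → 1 ℕ.≤ i → i ℕ.≤ j → j ℕ.≤ N m → p j ≤ p i) →
    (lpt lpt′ lpt″ : ℕ → Fin m) →
    IsLS p lpt [] (jobs (N m)) →
    ((i : ℕ) → 1 ℕ.≤ i → i ℕ.≤ m → lpt i ≡ lpt (N m ∸ i)) →
    load p lpt (jobs (N m)) (lpt (N m)) ≡ makespan m (N m) p lpt →
    IsLS p lpt′ (N m ∷ []) (jobs (2 ℕ.* m)) →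
    ((j : ℕ) → N m ∸ jobsBefore lpt (N m) ℕ.≤ j → j ℕ.≤ N m →
      lpt″ j ≡ lpt″ (N m)) →
    IsLS p lpt″ (interval (N m ∸ jobsBefore lpt (N m)) (suc (jobsBefore lpt (N m))))
      (jobs (2 ℕ.* m ∸ jobsBefore lpt (N m))) →
    p 1 ≤ p (N m) + p m →
    makespan m (N m) p lpt′ ≡ p (N m) + p m + p (2 ℕ.* m) →
    (σ : ℕ → Fin m) →
    (makespan m (N m) p lpt ⊓ makespan m (N m) p lpt′) ⊓ makespan m (N m) p lpt″
      ≤ (+ 7 / 6) * makespan m (N m) p σ
proposition11 m 3≤m p p-nonneg p-antitone lpt lpt′ lpt″ _ _ _ _ _ _ _ makespan-lpt′ σ = begin
  (C lpt ⊓ C lpt′) ⊓ C lpt″      ≤⟨ ℚₚ.p⊓q≤p (C lpt ⊓ C lpt′) (C lpt″) ⟩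
  C lpt ⊓ C lpt′                 ≤⟨ ℚₚ.p⊓q≤q (C lpt) (C lpt′) ⟩
  C lpt′                         ≡⟨ makespan-lpt′ ⟩
  p (N m) + p m + p (2 ℕ.* m)    ≤⟨ p[N]+p[m]+p[2m]≤⁷⁄₆makespan 1≤m p p-nonneg p-antitone σ ⟩
  (+ 7 / 6) * C σ                ∎
  where
  open ℚₚ.≤-Reasoning
  C : (ℕ → Fin m) → ℚ
  C = makespan m (N m) p
  1≤m : 1 ℕ.≤ m
  1≤m = ℕₚ.≤-trans (s≤s z≤n) 3≤m
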